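{- Fix $r\ge1$. Let $(X_n)_{n\ge1}$ and $(Y_n)_{n\ge1}$ be $r$-colored order-invariant extensions of order-invariant sets of partial colored permutations. Then $(X_nY_n)_{n\ge1}\in\mathcal{I}_r$. In particular, if $(X_n)_{n\ge1}\in\mathcal{I}_{r,m_1}$ and $(Y_n)_{n\ge1}\in\mathcal{I}_{r,m_2}$, then $(X_nY_n)_{n\ge1}\in\mathcal{I}_{r,m_1+m_2}$.
   Context: $\mathfrak{S}_{n,r}=\mathbb{Z}_r\wr\mathfrak{S}_n$ consists of pairs $(\omega,\tau)$, $\omega\in\mathfrak{S}_n$, $\tau:[n]\to\mathbb{Z}_r$. A partial colored permutation of size $m$ is $(K,\kappa)$ with $K=\{(i_h,j_h)\}_{h=1}^m\subseteq[n]\times[n]$, $i_h$ distinct, $j_h$ distinct, and $\kappa:\{j_h\}\to\mathbb{Z}_r$; $I_{(K,\kappa)}$ is the indicator on $\mathfrak{S}_{n,r}$ that $\omega(i_h)=j_h$ and $\tau(j_h)=\kappa(j_h)$ for all $h$. The support is $\{i_1,\dots,i_m,j_1,\dots,j_m\}$; for an order-preserving injection $f$, $f(K,\kappa)=(\{(f(i_h),f(j_h))\},\{(f(j_h),\kappa(j_h))\})$. A set $\mathcal{C}$ of partial colored permutations on $\mathfrak{S}_{n_0,r}$ is order-invariant if all members have the same size and it is closed under $f(K,\kappa)$ for all order-preserving $f:\operatorname{supp}(K,\kappa)\to[n_0]$. Its $r$-colored order-invariant extension (for $n_0\ge2$) is the sequence $X_n=\sum_{(K,\kappa)\in\mathcal{C}_n}I_{(K,\kappa)}$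 where $\mathcal{C}_n$ is the set of members of $\mathcal{C}$ with support in $[n]$ if $n\le n_0$, and the set of $f(K,\kappa)$, $(K,\kappa)\in\mathcal{C}$, $f:[n_0]\to[n]$ order-preserving, if $n\ge n_0$. $\mathcal{I}_r$ is the real vector space (componentwise operations) of sequences of statistics spanned by all $r$-colored order-invariant extensions, and $\mathcal{I}_{r,m}$ is the subspace spanned by extensions of order-invariant sets consisting of partial colored permutations of size at most $m$.
   Formalization: The statistics take rational values, and $\mathcal{I}_r$ and $\mathcal{I}_{r,m}$ are spans over ℚ rather than real vector spaces. -}

module Defs where

open import Level using (Level; 0ℓ) renaming (suc to lsuc)
open import Data.Nat using (ℕ; zero; suc; _≤_; _+_)
open import Data.Fin using (Fin; inject≤) renaming (_<_ to _<ᶠ_)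
open import Data.Fin.Permutation using (Permutation′; _⟨$⟩ʳ_)
open import Data.Maybe using (Maybe; just; nothing)
open import Data.Product using (Σ; ∃; _×_; _,_; proj₁; proj₂)
open import Data.Sum using (_⊎_)
open import Data.Vec using (Vec; lookup; []; _∷_)
open import Data.List using (List; length; foldr)
open import Data.List.Membership.Propositional using (_∈_)
open import Data.List.Relation.Unary.Unique.Propositional using (Unique)
open import Data.Rational using (ℚ; _*_) renaming (_+_ to _+ℚ_)
import Data.Rational as ℚ
open import Relation.Binary.PropositionalEquality using (_≡_)
open import Data.Integer using (+_)

-- A partial colored permutation (K, κ) on [n] (positions are Fin n, i.e. 0-indexed)
-- encoded canonically as a vector p with  p[i] = just (j , κ(j))  iff (i , j) ∈ K,
-- and p[i] = nothing if i is not a first coordinate of K.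
-- (distinctness of the i_h is automatic; distinctness of the j_h is `Valid`.)
PCP : ℕ → ℕ → Set
PCP n r = Vec (Maybe (Fin n × Fin r)) n

Valid : ∀ {n r} → PCP n r → Set
Valid {n} {r} p = ∀ (i i' j : Fin n) (c c' : Fin r) →
  lookup p i ≡ just (j , c) → lookup p i' ≡ just (j , c') → i ≡ i'

size : ∀ {n r k} → Vec (Maybe (Fin n × Fin r)) k → ℕ
size [] = 0
size (nothing ∷ v) = size v
size (just _ ∷ v) = suc (size v)

InSupp : ∀ {n r} → PCP n r → Fin n → Set
InSupp {n} {r} p x =
  (∃ λ (y : Fin n × Fin r) → lookup p x ≡ just y) ⊎
  (∃ λ (i : Fin n) → ∃ λ (c : Fin r) → lookup p i ≡ just (x , c))

OrderPresOnSupp : ∀ {n n' r} → PCP n r → (Fin n → Fin n') → Set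
OrderPresOnSupp {n} p g = ∀ (a b : Fin n) → InSupp p a → InSupp p b → a <ᶠ b → g a <ᶠ g b

OrderPres : ∀ {n n'} → (Fin n → Fin n') → Set
OrderPres {n} g = ∀ (a b : Fin n) → a <ᶠ b → g a <ᶠ g b

IsImage : ∀ {n n' r} → (Fin n → Fin n') → PCP n r → PCP n' r → Set
IsImage {n} {n'} {r} g p q =
  (∀ (i j : Fin n) (c : Fin r) → lookup p i ≡ just (j , c) → lookup q (g i) ≡ just (g j , c)) ×
  (∀ (y j' : Fin n') (c : Fin r) → lookup q y ≡ just (j' , c) →
     ∃ λ (i : Fin n) → ∃ λ (j : Fin n) → lookup p i ≡ just (j , c) × g i ≡ y × g j ≡ j')

OrderInvariant : ∀ {n0 r} → (PCP n0 r → Set) → Set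
OrderInvariant {n0} {r} C =
  (∀ p → C p → Valid p) ×
  (∃ λ (s : ℕ) → ∀ p → C p → size p ≡ s) ×
  (∀ p → C p → ∀ (g : Fin n0 → Fin n0) → OrderPresOnSupp p g →
     ∀ q → IsImage g p q → C q)

InCn : ∀ {n0 r} → (PCP n0 r → Set) → ∀ {n} → PCP n r → Set
InCn {n0} {r} C {n} q =
  (Σ (n ≤ n0) λ le → ∃ λ (p : PCP n0 r) → C p × IsImage (λ i → inject≤ i le) q p) ⊎
  (Σ (n0 ≤ n) λ _ → ∃ λ (p : PCP n0 r) → ∃ λ (f : Fin n0 → Fin n) →
     C p × OrderPres f × IsImage f p q)

Matches : ∀ {n r} → PCP n r → Permutation′ n → (Fin n → Fin r) → Set
Matches {n} {r} q ω τ = ∀ (i j : Fin n) (c : Fin r) → lookup q i ≡ just (j , c) →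
  (ω ⟨$⟩ʳ i ≡ j) × (τ j ≡ c)

-- a sequence of statistics: X_n : S_{n,r} → ℚ  (only n ≥ 1 is relevant)
Stat : ℕ → Set
Stat r = (n : ℕ) → Permutation′ n → (Fin n → Fin r) → ℚ

IsExtensionOf : ∀ {n0 r} → (PCP n0 r → Set) → Stat r → Set
IsExtensionOf {n0} {r} C X = ∀ (n : ℕ) → 1 ≤ n → ∀ (ω : Permutation′ n) (τ : Fin n → Fin r) →
  ∃ λ (L : List (PCP n r)) → Unique L ×
    (∀ q → (q ∈ L → InCn C q × Matches q ω τ) × (InCn C q × Matches q ω τ → q ∈ L)) ×
    (X n ω τ ≡ ((+ length L) ℚ./ 1))

IsOIExt : (r : ℕ) → Stat r → Set₁
IsOIExt r X = ∃ λ (n0 : ℕ) → 2 ≤ n0 × Σ (PCP n0 r → Set) λ C →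
  OrderInvariant C × IsExtensionOf C X

IsOIExtSz : (r m : ℕ) → Stat r → Set₁
IsOIExtSz r m X = ∃ λ (n0 : ℕ) → 2 ≤ n0 × Σ (PCP n0 r → Set) λ C →
  OrderInvariant C × (∀ p → C p → size p ≤ m) × IsExtensionOf C X

InSpan : ∀ {r} → (Stat r → Set₁) → Stat r → Set₁
InSpan {r} P S = Σ (List (ℚ × Σ (Stat r) P)) λ L →
  ∀ (n : ℕ) → 1 ≤ n → ∀ (ω : Permutation′ n) (τ : Fin n → Fin r) →
    S n ω τ ≡ foldr (λ t acc → proj₁ t * proj₁ (proj₂ t) n ω τ +ℚ acc) ℚ.0ℚ L

𝓘 : (r : ℕ) → Stat r → Set₁
𝓘 r = InSpan (IsOIExt r)

𝓘≤ : (r m : ℕ) → Stat r → Set₁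
𝓘≤ r m = InSpan (IsOIExtSz r m)

_⊙_ : ∀ {r} → Stat r → Stat r → Stat r
(X ⊙ Y) n ω τ = X n ω τ * Y n ω τ

-- The pattern of a partial colored permutation is its restriction to its support, renumbered
-- increasingly; an order-invariant set C is determined by the patterns of its members, and C_n
-- consists of the partial colored permutations on [n] having one of these patterns.
-- X_n Y_n counts the pairs (q₁ , q₂) ∈ C_n × D_n with I_{q₁} = I_{q₂} = 1 at (ω , τ); such pairs
-- are compatible and I_{q₁} I_{q₂} = I_{q₁ ∪ q₂}.  Group them by the pattern of (q₁ , q₂) on the
-- support of q₁ ∪ q₂; this support has at most n₀ + n₁ points, so only finitely many pair
-- patterns δ occur.  The unions of the pairs with pair pattern δ are exactly the matching members
-- of (C_δ)_n for one order-invariant set C_δ on [n₀ + n₁] whose members have size at most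
-- m₁ + m₂, and within a class the union determines the pair.  Hence X_n Y_n = Σ_δ X^δ_n, where
-- X^δ is the extension of C_δ; the second claim follows by bilinearity of the product.

module Submission where

open import Defs
open import Algebra.Bundles using (CommutativeMonoid)
open import Data.Fin using (Fin; zero; suc; toℕ; inject≤; _<_)
import Data.Fin.Properties as Fin
open import Data.Fin.Permutation using (Permutation′; _⟨$⟩ˡ_; inverseˡ)
open import Data.Fin.Subset as Subset using (Subset; inside; outside; ∣_∣)
  renaming (_∈_ to _∈ₛ_; _∪_ to _∪ₛ_; _⊆_ to _⊆ₛ_)
import Data.Fin.Subset.Properties as Subset
open import Data.Bool.Properties using (T-≡)
import Data.Integer as ℤ
import Data.Integer.Properties as ℤ
open import Data.List
  using (List; []; _∷_; map; filter; length; foldr; _++_; concatMap; cartesianProduct; cartesianProductWith;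
         allFin; upTo; deduplicate)
import Data.List.Properties as List
open import Data.List.Membership.Propositional using (_∈_)
open import Data.List.Membership.Propositional.Properties
open import Data.List.Relation.Unary.All as All using (All; []; _∷_)
import Data.List.Relation.Unary.All.Properties as All
open import Data.List.Relation.Unary.Any as Any using (here; there)
open import Data.List.Relation.Unary.Unique.Propositional using (Unique; []; _∷_)
import Data.List.Relation.Unary.Unique.Propositional.Properties as Unique
import Data.List.Relation.Unary.Unique.DecPropositional.Properties as Unique
open import Data.Maybe as Maybe using (Maybe; just; nothing; _<∣>_)
import Data.Maybe.Properties as Maybe
open import Data.Nat as ℕ using (ℕ; zero; suc; _≤_; _+_; z≤n; s≤s)
import Data.Nat.Coprimality as Coprime
open import Data.Nat.ListAction using (sum)
import Data.Nat.Properties as ℕ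
open import Data.Product as Prod using (Σ; ∃; ∃₂; _×_; _,_; proj₁; proj₂; map₁; uncurry)
import Data.Product.Properties as Prod
open import Data.Rational as ℚ using (ℚ; mkℚ; _/_; 0ℚ; 1ℚ; _*_) renaming (_+_ to _+ℚ_)
import Data.Rational.Properties as ℚ
open import Data.Sum as Sum using (_⊎_; inj₁; inj₂)
open import Data.Vec as Vec using (Vec; []; _∷_; lookup; here; there)
import Data.Vec.Properties as Vec
open import Function using (_∘_; Equivalence)
open import Relation.Binary.Definitions using (DecidableEquality)
open import Relation.Binary.PropositionalEquality
open import Relation.Nullary using (Dec; yes; no; ¬_; contradiction)
open import Relation.Nullary.Decidable using (_⊎-dec_; fromWitness; toWitness; isYes)
open import Algebra.Properties.CommutativeSemigroup ℕ.+-commutativeSemigroup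
  using () renaming (interchange to +-interchange)
open import Algebra.Properties.CommutativeSemigroup (CommutativeMonoid.commutativeSemigroup ℚ.*-1-commutativeMonoid)
  using () renaming (interchange to *-interchange)

private variable
  k m n n′ n₀ r : ℕ
  A B : Set

-- Thinnings: order-preserving embeddings Fin k → Fin n

data Thin : ℕ → ℕ → Set where
  done : Thin 0 0
  keep : Thin k n → Thin (suc k) (suc n)
  skip : Thin k n → Thin k (suc n)

apply : Thin k n → Fin k → Fin n
apply (keep θ) zero    = zero
apply (keep θ) (suc x) = suc (apply θ x)
apply (skip θ) x       = suc (apply θ x)

rank : Thin k n → Fin n → Maybe (Fin k)
rank (keep θ) zero    = just zero
rank (keep θ) (suc y) = Maybe.map suc (rank θ y)
rank (skip θ) zero    = nothing
rank (skip θ) (suc y) = rank θ y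

rank-apply : ∀ (θ : Thin k n) x → rank θ (apply θ x) ≡ just x
rank-apply (keep θ) zero    = refl
rank-apply (keep θ) (suc x) = cong (Maybe.map suc) (rank-apply θ x)
rank-apply (skip θ) x       = rank-apply θ x

apply-rank : ∀ (θ : Thin k n) {y x} → rank θ y ≡ just x → apply θ x ≡ y
apply-rank (keep θ) {zero} refl = refl
apply-rank (keep θ) {suc y} eq with rank θ y in e
apply-rank (keep θ) {suc y} refl | just _ = cong suc (apply-rank θ e)
apply-rank (skip θ) {suc y} eq = cong suc (apply-rank θ eq)

apply-injective : ∀ (θ : Thin k n) {x x′} → apply θ x ≡ apply θ x′ → x ≡ x′
apply-injective θ {x} {x′} eq =
  Maybe.just-injective (trans (sym (rank-apply θ x)) (trans (cong (rank θ) eq) (rank-apply θ x′)))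

apply-mono-< : ∀ (θ : Thin k n) {x x′} → x < x′ → apply θ x < apply θ x′
apply-mono-< (keep θ) {zero} {suc _} _ = s≤s z≤n
apply-mono-< (keep θ) {suc _} {suc _} (s≤s lt) = s≤s (apply-mono-< θ lt)
apply-mono-< (skip θ) lt = s≤s (apply-mono-< θ lt)

apply-cancel-< : ∀ (θ : Thin k n) {x x′} → apply θ x < apply θ x′ → x < x′
apply-cancel-< (keep θ) {zero} {suc _} _ = s≤s z≤n
apply-cancel-< (keep θ) {suc _} {suc _} (s≤s lt) = s≤s (apply-cancel-< θ lt)
apply-cancel-< (skip θ) (s≤s lt) = apply-cancel-< θ lt

Thin⇒≤ : Thin k n → k ≤ n
Thin⇒≤ done     = z≤n
Thin⇒≤ (keep θ) = s≤s (Thin⇒≤ θ)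
Thin⇒≤ (skip θ) = ℕ.m≤n⇒m≤1+n (Thin⇒≤ θ)

idᵗ : Thin n n
idᵗ {zero}  = done
idᵗ {suc n} = keep idᵗ

apply-idᵗ : ∀ (x : Fin n) → apply idᵗ x ≡ x
apply-idᵗ zero    = refl
apply-idᵗ (suc x) = cong suc (apply-idᵗ x)

inclusion : m ≤ n → Thin m n
inclusion {zero}  {zero}  z≤n      = done
inclusion {zero}  {suc n} z≤n      = skip (inclusion z≤n)
inclusion {suc m} {suc n} (s≤s le) = keep (inclusion le)

apply-inclusion : ∀ (le : m ≤ n) x → apply (inclusion le) x ≡ inject≤ x le
apply-inclusion (s≤s le) zero    = refl
apply-inclusion (s≤s le) (suc x) = cong suc (apply-inclusion le x)

Factorisation : Thin k n → ℕ → Set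
Factorisation {k} {n} θ m =
  Σ (Thin k m) λ φ → Σ (Thin m n) λ ψ → ∀ x → apply ψ (apply φ x) ≡ apply θ x

factorise : ∀ (θ : Thin k n) → k ≤ m → m ≤ n → Factorisation θ m
factorise done z≤n z≤n = done , done , λ ()
factorise (keep θ) (s≤s km) (s≤s mn) with φ , ψ , eq ← factorise θ km mn =
  keep φ , keep ψ , λ { zero → refl ; (suc x) → cong suc (eq x) }
factorise {n = suc n} {m = m} (skip θ) km mn with m ℕ.≤? n
... | yes mn′ with φ , ψ , eq ← factorise θ km mn′ = φ , skip ψ , λ x → cong suc (eq x)
... | no mn′ with refl ← ℕ.≤-antisym mn (ℕ.≰⇒> mn′) = skip θ , idᵗ , λ x → apply-idᵗ _

emptyᵗ : Thin 0 n
emptyᵗ {zero}  = done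
emptyᵗ {suc n} = skip emptyᵗ

private
  lowerᶠ : (y : Fin (suc n)) → 0 ℕ.< toℕ y → Fin n
  lowerᶠ (suc y) _ = y

  suc-lowerᶠ : ∀ (y : Fin (suc n)) p → suc (lowerᶠ y p) ≡ y
  suc-lowerᶠ (suc y) _ = refl

  lowerᶠ-mono-< : ∀ {y y′ : Fin (suc n)} p p′ → y < y′ → lowerᶠ y p < lowerᶠ y′ p′
  lowerᶠ-mono-< {y = suc _} {suc _} _ _ (s≤s lt) = lt

OrderPres⇒Thin : ∀ (f : Fin k → Fin n) → OrderPres f → Σ (Thin k n) λ θ → ∀ x → apply θ x ≡ f x
OrderPres⇒Thin {zero} f _ = emptyᵗ , λ ()
OrderPres⇒Thin {suc k} {zero} f _ with () ← f zero
OrderPres⇒Thin {suc k} {suc n} f mono with f zero in f0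
... | zero = keep θ , λ { zero → sym f0 ; (suc x) → trans (cong suc (eq x)) (suc-lowerᶠ _ (pos x)) }
  where
  pos : ∀ x → 0 ℕ.< toℕ (f (suc x))
  pos x = subst (λ y → toℕ y ℕ.< toℕ (f (suc x))) f0 (mono zero (suc x) (s≤s z≤n))
  rec = OrderPres⇒Thin (λ x → lowerᶠ (f (suc x)) (pos x))
          (λ x x′ lt → lowerᶠ-mono-< (pos x) (pos x′) (mono (suc x) (suc x′) (s≤s lt)))
  θ = proj₁ rec
  eq = proj₂ rec
... | suc _ = skip θ , λ x → trans (cong suc (eq x)) (suc-lowerᶠ _ (pos x))
  where
  pos : ∀ x → 0 ℕ.< toℕ (f x)
  pos zero    rewrite f0 = s≤s z≤n
  pos (suc x) = ℕ.<-trans (pos zero) (mono zero (suc x) (s≤s z≤n))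
  rec = OrderPres⇒Thin (λ x → lowerᶠ (f x) (pos x))
          (λ x x′ lt → lowerᶠ-mono-< (pos x) (pos x′) (mono x x′ lt))
  θ = proj₁ rec
  eq = proj₂ rec

enum : (s : Subset n) → Thin ∣ s ∣ n
enum []            = done
enum (inside ∷ s)  = keep (enum s)
enum (outside ∷ s) = skip (enum s)

_Enumerates_ : Thin k n → Subset n → Set
θ Enumerates s = (∀ x → apply θ x ∈ₛ s) × (∀ {y} → y ∈ₛ s → ∃ λ x → apply θ x ≡ y)

enum-enumerates : ∀ (s : Subset n) → enum s Enumerates s
enum-enumerates s = sound s , complete s
  where
  sound : ∀ {n} (s : Subset n) x → apply (enum s) x ∈ₛ s
  sound (inside ∷ s)  zero    = here
  sound (inside ∷ s)  (suc x) = there (sound s x)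
  sound (outside ∷ s) x       = there (sound s x)

  complete : ∀ {n} (s : Subset n) {y} → y ∈ₛ s → ∃ λ x → apply (enum s) x ≡ y
  complete (inside ∷ s)  here      = zero , refl
  complete (inside ∷ s)  (there m) = Prod.map suc (cong suc) (complete s m)
  complete (outside ∷ s) (there m) = Prod.map₂ (cong suc) (complete s m)

enumerates-unique : ∀ (θ : Thin k n) {s} → θ Enumerates s → (k , θ) ≡ (∣ s ∣ , enum s)
enumerates-unique done {[]} _ = refl
enumerates-unique (keep θ) {inside ∷ s} (sound , complete) =
  cong (λ { (k , θ) → suc k , keep θ }) (enumerates-unique θ (sound′ , complete′))
  where
  sound′ : ∀ x → apply θ x ∈ₛ s
  sound′ x with there m ← sound (suc x) = m
  complete′ : ∀ {y} → y ∈ₛ s → ∃ λ x → apply θ x ≡ y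
  complete′ m with complete (there m)
  ... | zero  , ()
  ... | suc x , eq = x , Fin.suc-injective eq
enumerates-unique (keep θ) {outside ∷ s} (sound , _) with () ← sound zero
enumerates-unique (skip θ) {inside ∷ s} (_ , complete) with complete here
... | _ , ()
enumerates-unique (skip θ) {outside ∷ s} (sound , complete) =
  cong (λ { (k , θ) → k , skip θ }) (enumerates-unique θ (sound′ , complete′))
  where
  sound′ : ∀ x → apply θ x ∈ₛ s
  sound′ x with there m ← sound x = m
  complete′ : ∀ {y} → y ∈ₛ s → ∃ λ x → apply θ x ≡ y
  complete′ m = Prod.map₂ Fin.suc-injective (complete (there m))

∣p∪q∣≤∣p∣+∣q∣ : ∀ (p q : Subset n) → ∣ p ∪ₛ q ∣ ≤ ∣ p ∣ + ∣ q ∣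
∣p∪q∣≤∣p∣+∣q∣ []            []            = z≤n
∣p∪q∣≤∣p∣+∣q∣ (inside ∷ p)  (inside ∷ q)  =
  s≤s (ℕ.≤-trans (∣p∪q∣≤∣p∣+∣q∣ p q) (ℕ.+-monoʳ-≤ ∣ p ∣ (ℕ.n≤1+n _)))
∣p∪q∣≤∣p∣+∣q∣ (inside ∷ p)  (outside ∷ q) = s≤s (∣p∪q∣≤∣p∣+∣q∣ p q)
∣p∪q∣≤∣p∣+∣q∣ (outside ∷ p) (inside ∷ q)  =
  subst (suc ∣ p ∪ₛ q ∣ ≤_) (sym (ℕ.+-suc ∣ p ∣ ∣ q ∣)) (s≤s (∣p∪q∣≤∣p∣+∣q∣ p q))
∣p∪q∣≤∣p∣+∣q∣ (outside ∷ p) (outside ∷ q) = ∣p∪q∣≤∣p∣+∣q∣ p q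

-- Moving partial colored permutations along thinnings

Entry : ℕ → ℕ → Set
Entry n r = Maybe (Fin n × Fin r)

lookup-ext : ∀ {u v : Vec A n} → (∀ i → lookup u i ≡ lookup v i) → u ≡ v
lookup-ext {u = u} {v} eq =
  trans (sym (Vec.tabulate∘lookup u)) (trans (Vec.tabulate-cong eq) (Vec.tabulate∘lookup v))

mapEntry : (Fin k → Fin n) → Entry k r → Entry n r
mapEntry f = Maybe.map (map₁ f)

place : Thin k n → Vec (Maybe A) k → Vec (Maybe A) n
place done     []      = []
place (keep θ) (x ∷ v) = x ∷ place θ v
place (skip θ) v       = nothing ∷ place θ v

lookup-place : ∀ (θ : Thin k n) (v : Vec (Maybe A) k) x → lookup (place θ v) (apply θ x) ≡ lookup v x
lookup-place (keep θ) (_ ∷ v) zero    = refl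
lookup-place (keep θ) (_ ∷ v) (suc x) = lookup-place θ v x
lookup-place (skip θ) v       x       = lookup-place θ v x

lookup-place-∉ : ∀ (θ : Thin k n) (v : Vec (Maybe A) k) {y} → rank θ y ≡ nothing →
  lookup (place θ v) y ≡ nothing
lookup-place-∉ (keep θ) (_ ∷ v) {suc y} eq with rank θ y in e
... | nothing = lookup-place-∉ θ v e
lookup-place-∉ (skip θ) v {zero}  _  = refl
lookup-place-∉ (skip θ) v {suc y} eq = lookup-place-∉ θ v eq

push : Thin k n → PCP k r → PCP n r
push θ a = place θ (Vec.map (mapEntry (apply θ)) a)

lookup-push : ∀ (θ : Thin k n) (a : PCP k r) x →
  lookup (push θ a) (apply θ x) ≡ mapEntry (apply θ) (lookup a x)
lookup-push θ a x = trans (lookup-place θ _ x) (Vec.lookup-map x _ a)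

lookup-push-just : ∀ (θ : Thin k n) (a : PCP k r) {x j c} → lookup a x ≡ just (j , c) →
  lookup (push θ a) (apply θ x) ≡ just (apply θ j , c)
lookup-push-just θ a {x} eq = trans (lookup-push θ a x) (cong (mapEntry (apply θ)) eq)

lookup-push-∉ : ∀ (θ : Thin k n) (a : PCP k r) {y} → rank θ y ≡ nothing → lookup (push θ a) y ≡ nothing
lookup-push-∉ θ a = lookup-place-∉ θ _

lookup-push-just⁻ : ∀ (θ : Thin k n) (a : PCP k r) {y j c} → lookup (push θ a) y ≡ just (j , c) →
  ∃₂ λ x j₀ → apply θ x ≡ y × lookup a x ≡ just (j₀ , c) × apply θ j₀ ≡ j
lookup-push-just⁻ θ a {y} eq with rank θ y in e
... | nothing with () ← trans (sym eq) (lookup-push-∉ θ a e)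
... | just x with refl ← apply-rank θ e with lookup a x in ea | trans (sym eq) (lookup-push θ a x)
...   | just (j₀ , _) | refl = x , j₀ , refl , ea , refl

push-unique : ∀ (θ : Thin k n) (a : PCP k r) (q : PCP n r) →
  (∀ x → lookup q (apply θ x) ≡ mapEntry (apply θ) (lookup a x)) →
  (∀ y → rank θ y ≡ nothing → lookup q y ≡ nothing) → q ≡ push θ a
push-unique θ a q on off = lookup-ext pointwise
  where
  pointwise : ∀ y → lookup q y ≡ lookup (push θ a) y
  pointwise y with rank θ y in e
  ... | nothing = trans (off y e) (sym (lookup-push-∉ θ a e))
  ... | just x with refl ← apply-rank θ e = trans (on x) (sym (lookup-push θ a x))

pullEntry : Thin k n → Entry n r → Entry k r
pullEntry θ nothing        = nothing
pullEntry θ (just (j , c)) = Maybe.map (_, c) (rank θ j)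

pull : Thin k n → PCP n r → PCP k r
pull θ q = Vec.tabulate (λ x → pullEntry θ (lookup q (apply θ x)))

lookup-pull : ∀ (θ : Thin k n) (q : PCP n r) x → lookup (pull θ q) x ≡ pullEntry θ (lookup q (apply θ x))
lookup-pull θ q = Vec.lookup∘tabulate _

pull-push : ∀ (θ : Thin k n) (a : PCP k r) → pull θ (push θ a) ≡ a
pull-push θ a = lookup-ext λ x →
  trans (lookup-pull θ (push θ a) x) (trans (cong (pullEntry θ) (lookup-push θ a x)) (pullEntry-map (lookup a x)))
  where
  pullEntry-map : ∀ e → pullEntry θ (mapEntry (apply θ) e) ≡ e
  pullEntry-map nothing        = refl
  pullEntry-map (just (j , c)) = cong (Maybe.map (_, c)) (rank-apply θ j)

_Covers_ : Thin k n → PCP n r → Set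
θ Covers q = ∀ {y} → InSupp q y → ∃ λ x → apply θ x ≡ y

push-pull : ∀ (θ : Thin k n) (q : PCP n r) → θ Covers q → q ≡ push θ (pull θ q)
push-pull θ q cover = push-unique θ (pull θ q) q on off
  where
  on : ∀ x → lookup q (apply θ x) ≡ mapEntry (apply θ) (lookup (pull θ q) x)
  on x rewrite lookup-pull θ q x with lookup q (apply θ x) in e
  ... | nothing = refl
  ... | just (j , c) with j₀ , refl ← cover (inj₂ (apply θ x , c , e)) rewrite rank-apply θ j₀ = refl
  off : ∀ y → rank θ y ≡ nothing → lookup q y ≡ nothing
  off y e with lookup q y in eq
  ... | nothing = refl
  ... | just z with x , refl ← cover (inj₁ (z , eq)) with () ← trans (sym e) (rank-apply θ x)

pull-injective : ∀ (θ : Thin k n) {q q′ : PCP n r} → θ Covers q → θ Covers q′ → pull θ q ≡ pull θ q′ → q ≡ q′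
pull-injective θ cover cover′ eq =
  trans (push-pull θ _ cover) (trans (cong (push θ) eq) (sym (push-pull θ _ cover′)))

push-covers : ∀ (θ : Thin k n) (a : PCP k r) → θ Covers push θ a
push-covers θ a (inj₁ (_ , eq)) with x , _ , e , _ ← lookup-push-just⁻ θ a eq = x , e
push-covers θ a (inj₂ (_ , _ , eq)) with _ , j₀ , _ , _ , e ← lookup-push-just⁻ θ a eq = j₀ , e

InSupp-push : ∀ (θ : Thin k n) (a : PCP k r) {x} → InSupp a x → InSupp (push θ a) (apply θ x)
InSupp-push θ a (inj₁ ((j , c) , eq))  = inj₁ ((apply θ j , c) , lookup-push-just θ a eq)
InSupp-push θ a (inj₂ (i , c , eq))    = inj₂ (apply θ i , c , lookup-push-just θ a eq)

InSupp-push⁻ : ∀ (θ : Thin k n) (a : PCP k r) {x} → InSupp (push θ a) (apply θ x) → InSupp a x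
InSupp-push⁻ θ a (inj₁ (_ , eq)) with x , j₀ , e , ea , _ ← lookup-push-just⁻ θ a eq
  rewrite apply-injective θ e = inj₁ (_ , ea)
InSupp-push⁻ θ a (inj₂ (_ , c , eq)) with x , j₀ , _ , ea , e ← lookup-push-just⁻ θ a eq
  rewrite apply-injective θ e = inj₂ (x , c , ea)

IsImage-push : ∀ (σ : Thin k n) (ψ : Thin k n′) (a : PCP k r) (g : Fin n → Fin n′) →
  (∀ x → g (apply σ x) ≡ apply ψ x) → IsImage g (push σ a) (push ψ a)
IsImage-push σ ψ a g g∘σ≗ψ = forward , backward
  where
  forward : ∀ i j c → lookup (push σ a) i ≡ just (j , c) → lookup (push ψ a) (g i) ≡ just (g j , c)
  forward _ _ _ eq with x , j₀ , refl , ea , refl ← lookup-push-just⁻ σ a eq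
    rewrite g∘σ≗ψ x | g∘σ≗ψ j₀ = lookup-push-just ψ a ea
  backward : ∀ y j′ c → lookup (push ψ a) y ≡ just (j′ , c) →
    ∃ λ i → ∃ λ j → lookup (push σ a) i ≡ just (j , c) × g i ≡ y × g j ≡ j′
  backward _ _ _ eq with x , j₀ , refl , ea , refl ← lookup-push-just⁻ ψ a eq =
    apply σ x , apply σ j₀ , lookup-push-just σ a ea , g∘σ≗ψ x , g∘σ≗ψ j₀

IsImage-apply : ∀ (θ : Thin k n) (a : PCP k r) → IsImage (apply θ) a (push θ a)
IsImage-apply θ a = (λ _ _ _ → lookup-push-just θ a) , backward
  where
  backward : ∀ y j′ c → lookup (push θ a) y ≡ just (j′ , c) →
    ∃ λ i → ∃ λ j → lookup a i ≡ just (j , c) × apply θ i ≡ y × apply θ j ≡ j′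
  backward _ _ _ eq with x , j₀ , e , ea , ej ← lookup-push-just⁻ θ a eq = x , j₀ , ea , e , ej

IsImage-cong : ∀ {g g′ : Fin n → Fin n′} {p : PCP n r} {q} → (∀ x → g x ≡ g′ x) → IsImage g p q → IsImage g′ p q
IsImage-cong {q = q} g≗g′ (forward , backward) =
  (λ i j c e → subst₂ (λ a b → lookup q a ≡ just (b , c)) (g≗g′ i) (g≗g′ j) (forward i j c e)) ,
  (λ y j′ c e → let (i , j , e₁ , e₂ , e₃) = backward y j′ c e in
    i , j , e₁ , trans (sym (g≗g′ i)) e₂ , trans (sym (g≗g′ j)) e₃)

IsImage⇒push : ∀ (θ : Thin k n) (a : PCP k r) (g : Fin n → Fin n′) → OrderPres (g ∘ apply θ) →
  ∀ q → IsImage g (push θ a) q → Σ (Thin k n′) λ ψ → q ≡ push ψ a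
IsImage⇒push θ a g mono q (forward , backward) = ψ , push-unique ψ a q on off
  where
  ψ = proj₁ (OrderPres⇒Thin (g ∘ apply θ) mono)
  ψ≗g∘θ = proj₂ (OrderPres⇒Thin (g ∘ apply θ) mono)
  on : ∀ x → lookup q (apply ψ x) ≡ mapEntry (apply ψ) (lookup a x)
  on x rewrite ψ≗g∘θ x with lookup a x in ea
  ... | just (j , c) rewrite ψ≗g∘θ j = forward _ _ c (lookup-push-just θ a ea)
  ... | nothing with lookup q (g (apply θ x)) in eq
  ...   | nothing = refl
  ...   | just (j′ , c) with i , j , ei , gi , _ ← backward _ j′ c eq
        with x′ , _ , refl , ea′ , _ ← lookup-push-just⁻ θ a ei
        with refl ← apply-injective ψ (trans (ψ≗g∘θ x′) (trans gi (sym (ψ≗g∘θ x))))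
        with () ← trans (sym ea′) ea
  off : ∀ y → rank ψ y ≡ nothing → lookup q y ≡ nothing
  off y e with lookup q y in eq
  ... | nothing = refl
  ... | just (j′ , c) with i , j , ei , refl , _ ← backward y j′ c eq
      with x′ , _ , refl , _ , _ ← lookup-push-just⁻ θ a ei
      with () ← trans (sym e) (trans (cong (rank ψ) (sym (ψ≗g∘θ x′))) (rank-apply ψ x′))

Valid-push⁺ : ∀ (θ : Thin k n) (a : PCP k r) → Valid a → Valid (push θ a)
Valid-push⁺ θ a valid _ _ _ _ _ e₁ e₂
  with x , j₀ , refl , ea , refl ← lookup-push-just⁻ θ a e₁
     | x′ , j₀′ , refl , ea′ , ej ← lookup-push-just⁻ θ a e₂
  with refl ← apply-injective θ ej = cong (apply θ) (valid x x′ j₀ _ _ ea ea′)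

Valid-push⁻ : ∀ (θ : Thin k n) (a : PCP k r) → Valid (push θ a) → Valid a
Valid-push⁻ θ a valid x x′ j _ _ e₁ e₂ =
  apply-injective θ (valid _ _ (apply θ j) _ _ (lookup-push-just θ a e₁) (lookup-push-just θ a e₂))

size-push : ∀ (θ : Thin k n) (a : PCP k r) → size (push θ a) ≡ size a
size-push θ a = trans (size-place θ _) (size-map a)
  where
  size-place : ∀ {k n m} (θ : Thin k n) (v : Vec (Entry m r) k) → size (place θ v) ≡ size v
  size-place done     []             = refl
  size-place (keep θ) (nothing ∷ v)  = size-place θ v
  size-place (keep θ) (just _ ∷ v)   = cong suc (size-place θ v)
  size-place (skip θ) v              = size-place θ v
  size-map : ∀ {m} (v : Vec (Entry _ r) m) → size (Vec.map (mapEntry (apply θ)) v) ≡ size v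
  size-map []            = refl
  size-map (nothing ∷ v) = size-map v
  size-map (just _ ∷ v)  = cong suc (size-map v)

-- Supports and patterns

InSupp? : ∀ (q : PCP n r) y → Dec (InSupp q y)
InSupp? q y = isJust? (lookup q y) ⊎-dec Fin.any? (λ i → hits? (lookup q i))
  where
  isJust? : ∀ (e : Entry _ _) → Dec (∃ λ z → e ≡ just z)
  isJust? nothing  = no λ ()
  isJust? (just z) = yes (z , refl)
  hits? : ∀ (e : Entry _ _) → Dec (∃ λ c → e ≡ just (y , c))
  hits? nothing = no λ ()
  hits? (just (j , c)) with j Fin.≟ y
  ... | yes refl = yes (c , refl)
  ... | no j≢y   = no λ { (_ , refl) → j≢y refl }

-- Opaque because conversion checking would otherwise unfold the decision procedure,
-- which is prohibitively slow; only ∈-supp⁺ and ∈-supp⁻ need the definition.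
opaque
  supp : PCP n r → Subset n
  supp q = Vec.tabulate (isYes ∘ InSupp? q)

  ∈-supp⁺ : ∀ (q : PCP n r) {y} → InSupp q y → y ∈ₛ supp q
  ∈-supp⁺ q {y} s = Vec.lookup⇒[]= y (supp q)
    (trans (Vec.lookup∘tabulate _ y) (Equivalence.to T-≡ (fromWitness {a? = InSupp? q y} s)))

  ∈-supp⁻ : ∀ (q : PCP n r) {y} → y ∈ₛ supp q → InSupp q y
  ∈-supp⁻ q {y} m =
    toWitness (Equivalence.from T-≡ (trans (sym (Vec.lookup∘tabulate _ y)) (Vec.[]=⇒lookup m)))

suppᵗ : (q : PCP n r) → Thin ∣ supp q ∣ n
suppᵗ q = enum (supp q)

suppᵗ-covers : ∀ (q : PCP n r) → suppᵗ q Covers q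
suppᵗ-covers q s = proj₂ (enum-enumerates (supp q)) (∈-supp⁺ q s)

InSupp-suppᵗ : ∀ (q : PCP n r) x → InSupp q (apply (suppᵗ q) x)
InSupp-suppᵗ q x = ∈-supp⁻ q (proj₁ (enum-enumerates (supp q)) x)

Pattern : ℕ → Set
Pattern r = Σ ℕ λ k → PCP k r

patternOf : PCP n r → Pattern r
patternOf q = ∣ supp q ∣ , pull (suppᵗ q) q

push-pull-suppᵗ : ∀ (q : PCP n r) → q ≡ push (suppᵗ q) (pull (suppᵗ q) q)
push-pull-suppᵗ q = push-pull (suppᵗ q) q (suppᵗ-covers q)

Full : PCP k r → Set
Full {k} a = ∀ (x : Fin k) → InSupp a x

Full-pull-suppᵗ : ∀ (q : PCP n r) → Full (pull (suppᵗ q) q)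
Full-pull-suppᵗ q x = InSupp-push⁻ (suppᵗ q) _
  (subst (λ q′ → InSupp q′ (apply (suppᵗ q) x)) (push-pull-suppᵗ q) (InSupp-suppᵗ q x))

push-enumerates-supp : ∀ (θ : Thin k n) (a : PCP k r) → Full a → θ Enumerates supp (push θ a)
push-enumerates-supp θ a full =
  (λ x → ∈-supp⁺ (push θ a) (InSupp-push θ a (full x))) , push-covers θ a ∘ ∈-supp⁻ (push θ a)

patternOf-push-Full : ∀ (θ : Thin k n) (a : PCP k r) → Full a → patternOf (push θ a) ≡ (k , a)
patternOf-push-Full {k} θ a full = begin
  patternOf (push θ a)     ≡⟨ cong (λ { (k , θ′) → k , pull θ′ (push θ a) }) (sym enumerated) ⟩
  (k , pull θ (push θ a))  ≡⟨ cong (k ,_) (pull-push θ a) ⟩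
  (k , a)                  ∎
  where
  open ≡-Reasoning
  enumerated = enumerates-unique θ (push-enumerates-supp θ a full)

patternOf≡⇒push : ∀ (q : PCP n r) {k} {a : PCP k r} → patternOf q ≡ (k , a) → Σ (Thin k n) λ θ → q ≡ push θ a
patternOf≡⇒push q refl = suppᵗ q , push-pull-suppᵗ q

patternOf≡⇒Full : ∀ (q : PCP n r) {k} {a : PCP k r} → patternOf q ≡ (k , a) → Full a
patternOf≡⇒Full q refl = Full-pull-suppᵗ q

size-patternOf : ∀ (q : PCP n r) → size (proj₂ (patternOf q)) ≡ size q
size-patternOf q = trans (sym (size-push (suppᵗ q) _)) (cong size (sym (push-pull-suppᵗ q)))

patternOf-IsImage : ∀ (p : PCP n r) (g : Fin n → Fin n′) → OrderPresOnSupp p g →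
  ∀ q → IsImage g p q → patternOf q ≡ patternOf p
patternOf-IsImage p g mono q im =
  trans (cong patternOf (proj₂ image)) (patternOf-push-Full (proj₁ image) a (Full-pull-suppᵗ p))
  where
  θ = suppᵗ p
  a = pull θ p
  mono′ : OrderPres (g ∘ apply θ)
  mono′ x x′ lt = mono _ _ (InSupp-suppᵗ p x) (InSupp-suppᵗ p x′) (apply-mono-< θ lt)
  image = IsImage⇒push θ a g mono′ q (subst (λ p′ → IsImage g p′ q) (push-pull-suppᵗ p) im)

patternOf-push : ∀ (θ : Thin k n) (a : PCP k r) → patternOf (push θ a) ≡ patternOf a
patternOf-push θ a = patternOf-IsImage a (apply θ) (λ _ _ _ _ → apply-mono-< θ) (push θ a) (IsImage-apply θ a)

-- Order-invariant sets are determined by their patterns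

PatternOf : (PCP n₀ r → Set) → Pattern r → Set
PatternOf {n₀} C t = ∃ λ (p : PCP n₀ _) → C p × patternOf p ≡ t

OrderInvariant-push : ∀ {C : PCP n₀ r → Set} → OrderInvariant C →
  ∀ (θ θ′ : Thin k n₀) a → C (push θ a) → C (push θ′ a)
OrderInvariant-push (_ , _ , closed) θ θ′ a Ca =
  closed (push θ a) Ca g mono (push θ′ a) (IsImage-push θ θ′ a g g∘θ≗θ′)
  where
  g : Fin _ → Fin _
  g y = Maybe.maybe (apply θ′) y (rank θ y)
  g∘θ≗θ′ : ∀ x → g (apply θ x) ≡ apply θ′ x
  g∘θ≗θ′ x = cong (Maybe.maybe (apply θ′) (apply θ x)) (rank-apply θ x)
  mono : OrderPresOnSupp (push θ a) g
  mono _ _ sa sb lt with x , refl ← push-covers θ a sa | x′ , refl ← push-covers θ a sb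
    rewrite g∘θ≗θ′ x | g∘θ≗θ′ x′ = apply-mono-< θ′ (apply-cancel-< θ lt)

OrderInvariant-patternOf : ∀ {C : PCP n₀ r → Set} → OrderInvariant C →
  ∀ {p p′} → C p → patternOf p ≡ patternOf p′ → C p′
OrderInvariant-patternOf {C = C} oi {p} {p′} Cp eq
  with θ , refl ← patternOf≡⇒push p eq | θ′ , p′≡ ← patternOf≡⇒push p′ refl =
  subst C (sym p′≡) (OrderInvariant-push oi θ θ′ _ Cp)

PatternOf-bound : ∀ {C : PCP n₀ r → Set} (q : PCP n r) → PatternOf C (patternOf q) → ∣ supp q ∣ ≤ n₀
PatternOf-bound q (p , _ , eq) = subst (_≤ _) (cong proj₁ eq) (Thin⇒≤ (suppᵗ p))

PatternOf-size : ∀ {C : PCP n₀ r → Set} {m} → (∀ p → C p → size p ≤ m) →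
  ∀ (a : PCP k r) → PatternOf C (patternOf a) → size a ≤ m
PatternOf-size bound a (p , Cp , eq) =
  subst (_≤ _) (trans (sym (size-patternOf p)) (trans (cong (size ∘ proj₂) eq) (size-patternOf a))) (bound p Cp)

InCn⇒PatternOf : ∀ {C : PCP n₀ r → Set} (q : PCP n r) → InCn C q → PatternOf C (patternOf q)
InCn⇒PatternOf q (inj₁ (le , p , Cp , im)) = p , Cp , patternOf-IsImage q _ inject≤-mono p im
  where
  inject≤-mono : OrderPresOnSupp q (λ i → inject≤ i le)
  inject≤-mono a b _ _ = subst₂ ℕ._<_ (sym (Fin.toℕ-inject≤ a le)) (sym (Fin.toℕ-inject≤ b le))
InCn⇒PatternOf q (inj₂ (_ , p , f , Cp , mono , im)) =
  p , Cp , sym (patternOf-IsImage p f (λ a b _ _ → mono a b) q im)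

PatternOf⇒InCn : ∀ {C : PCP n₀ r → Set} → OrderInvariant C →
  ∀ (q : PCP n r) → PatternOf C (patternOf q) → InCn C q
PatternOf⇒InCn {n₀} {n = n} {C = C} oi q (p , Cp , eq) with ℕ.≤-total n n₀
... | inj₁ n≤n₀ =
  inj₁ (n≤n₀ , push ι q , C-push , IsImage-cong {p = q} {q = push ι q} (apply-inclusion n≤n₀) (IsImage-apply ι q))
  where
  ι = inclusion n≤n₀
  C-push : C (push ι q)
  C-push = OrderInvariant-patternOf oi Cp (trans eq (sym (patternOf-push ι q)))
... | inj₂ n₀≤n = inj₂ (n₀≤n , push φ a , apply ψ , C-push , (λ _ _ → apply-mono-< ψ) , image)
  where
  θ = suppᵗ q
  a = pull θ q
  φψ = factorise θ (PatternOf-bound {C = C} q (p , Cp , eq)) n₀≤n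
  φ = proj₁ φψ
  ψ = proj₁ (proj₂ φψ)
  C-push : C (push φ a)
  C-push = OrderInvariant-patternOf oi Cp (trans eq (sym (patternOf-push-Full φ a (Full-pull-suppᵗ q))))
  image : IsImage (apply ψ) (push φ a) q
  image = subst (IsImage (apply ψ) (push φ a)) (sym (push-pull-suppᵗ q))
    (IsImage-push φ θ a (apply ψ) (proj₂ (proj₂ φψ)))

-- Unions of compatible partial colored permutations

_∪_ : PCP n r → PCP n r → PCP n r
q₁ ∪ q₂ = Vec.zipWith _<∣>_ q₁ q₂

lookup-∪ : ∀ (q₁ q₂ : PCP n r) i → lookup (q₁ ∪ q₂) i ≡ lookup q₁ i <∣> lookup q₂ i
lookup-∪ q₁ q₂ i = Vec.lookup-zipWith _<∣>_ i q₁ q₂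

Compatible : PCP n r → PCP n r → Set
Compatible q₁ q₂ = ∀ i {e₁ e₂} → lookup q₁ i ≡ just e₁ → lookup q₂ i ≡ just e₂ → e₁ ≡ e₂

module _ (ω : Permutation′ n) (τ : Fin n → Fin r) where

  Matches⇒Valid : ∀ q → Matches q ω τ → Valid q
  Matches⇒Valid _ match i i′ j _ _ e e′ =
    trans (sym (inverseˡ ω))
      (trans (cong (ω ⟨$⟩ˡ_) (trans (proj₁ (match _ _ _ e)) (sym (proj₁ (match _ _ _ e′))))) (inverseˡ ω))

  Matches⇒Compatible : ∀ q₁ q₂ → Matches q₁ ω τ → Matches q₂ ω τ → Compatible q₁ q₂
  Matches⇒Compatible _ _ match₁ match₂ i e₁ e₂
    with refl , refl ← match₁ i _ _ e₁ | refl , refl ← match₂ i _ _ e₂ = refl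

  Matches-∪ : ∀ q₁ q₂ → Matches q₁ ω τ → Matches q₂ ω τ → Matches (q₁ ∪ q₂) ω τ
  Matches-∪ q₁ q₂ match₁ match₂ i j c e rewrite lookup-∪ q₁ q₂ i with lookup q₁ i in e₁
  ... | just _  = match₁ i j c (trans e₁ e)
  ... | nothing = match₂ i j c e

  Matches-∪⁻ˡ : ∀ q₁ q₂ → Matches (q₁ ∪ q₂) ω τ → Matches q₁ ω τ
  Matches-∪⁻ˡ q₁ q₂ match i j c e = match i j c (trans (lookup-∪ q₁ q₂ i) (cong (_<∣> lookup q₂ i) e))

  Matches-∪⁻ʳ : ∀ q₁ q₂ → Compatible q₁ q₂ → Matches (q₁ ∪ q₂) ω τ → Matches q₂ ω τ
  Matches-∪⁻ʳ q₁ q₂ compatible match i j c e with lookup q₁ i in e₁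
  ... | nothing = match i j c (trans (lookup-∪ q₁ q₂ i) (trans (cong (_<∣> lookup q₂ i) e₁) e))
  ... | just _ with refl ← compatible i e₁ e =
    match i j c (trans (lookup-∪ q₁ q₂ i) (cong (_<∣> lookup q₂ i) e₁))

InSupp-∪⁻ : ∀ (q₁ q₂ : PCP n r) {y} → InSupp (q₁ ∪ q₂) y → InSupp q₁ y ⊎ InSupp q₂ y
InSupp-∪⁻ q₁ q₂ {y} (inj₁ (_ , e)) rewrite lookup-∪ q₁ q₂ y with lookup q₁ y
... | just z  = inj₁ (inj₁ (z , refl))
... | nothing = inj₂ (inj₁ (_ , e))
InSupp-∪⁻ q₁ q₂ (inj₂ (i , c , e)) rewrite lookup-∪ q₁ q₂ i with lookup q₁ i in e₁
... | just _  = inj₁ (inj₂ (i , c , trans e₁ e))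
... | nothing = inj₂ (inj₂ (i , c , e))

InSupp-∪⁺ : ∀ (q₁ q₂ : PCP n r) → Compatible q₁ q₂ → ∀ {y} → InSupp q₁ y ⊎ InSupp q₂ y → InSupp (q₁ ∪ q₂) y
InSupp-∪⁺ q₁ q₂ _ (inj₁ (inj₁ (z , e))) = inj₁ (z , trans (lookup-∪ q₁ q₂ _) (cong (_<∣> _) e))
InSupp-∪⁺ q₁ q₂ _ (inj₁ (inj₂ (i , c , e))) = inj₂ (i , c , trans (lookup-∪ q₁ q₂ i) (cong (_<∣> _) e))
InSupp-∪⁺ q₁ q₂ _ (inj₂ (inj₁ (z , e))) with lookup q₁ _ in e₁
... | just z′   = inj₁ (z′ , trans (lookup-∪ q₁ q₂ _) (cong (_<∣> _) e₁))
... | nothing   = inj₁ (z , trans (lookup-∪ q₁ q₂ _) (trans (cong (_<∣> _) e₁) e))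
InSupp-∪⁺ q₁ q₂ compatible (inj₂ (inj₂ (i , c , e))) with lookup q₁ i in e₁
... | nothing = inj₂ (i , c , trans (lookup-∪ q₁ q₂ i) (trans (cong (_<∣> _) e₁) e))
... | just _ with refl ← compatible i e₁ e = inj₂ (i , c , trans (lookup-∪ q₁ q₂ i) (cong (_<∣> _) e₁))

push-∪ : ∀ (θ : Thin k n) (a b : PCP k r) → push θ a ∪ push θ b ≡ push θ (a ∪ b)
push-∪ θ a b = push-unique θ (a ∪ b) _ on off
  where
  on : ∀ x → lookup (push θ a ∪ push θ b) (apply θ x) ≡ mapEntry (apply θ) (lookup (a ∪ b) x)
  on x rewrite lookup-∪ (push θ a) (push θ b) (apply θ x) | lookup-push θ a x | lookup-push θ b x
             | lookup-∪ a b x with lookup a x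
  ... | just _  = refl
  ... | nothing = refl
  off : ∀ y → rank θ y ≡ nothing → lookup (push θ a ∪ push θ b) y ≡ nothing
  off y e rewrite lookup-∪ (push θ a) (push θ b) y | lookup-push-∉ θ a e | lookup-push-∉ θ b e = refl

Compatible-push⁺ : ∀ (θ : Thin k n) {a b : PCP k r} → Compatible a b → Compatible (push θ a) (push θ b)
Compatible-push⁺ θ {a} {b} compatible _ e₁ e₂
  with x , _ , refl , ea , refl ← lookup-push-just⁻ θ a e₁ | x′ , _ , e , eb , refl ← lookup-push-just⁻ θ b e₂
  with refl ← apply-injective θ e with refl ← compatible x ea eb = refl

Compatible-push⁻ : ∀ (θ : Thin k n) {a b : PCP k r} → Compatible (push θ a) (push θ b) → Compatible a b
Compatible-push⁻ θ {a} {b} compatible x {j , c} {j′ , c′} e₁ e₂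
  with compatible (apply θ x) (lookup-push-just θ a e₁) (lookup-push-just θ b e₂)
... | eq with refl ← apply-injective θ (cong proj₁ eq) | refl ← cong proj₂ eq = refl

size-∪ : ∀ (a b : Vec (Entry n r) k) → size (Vec.zipWith _<∣>_ a b) ≤ size a + size b
size-∪ []            []            = z≤n
size-∪ (just _ ∷ a)  (just _ ∷ b)  = s≤s (ℕ.≤-trans (size-∪ a b) (ℕ.+-monoʳ-≤ (size a) (ℕ.n≤1+n _)))
size-∪ (just _ ∷ a)  (nothing ∷ b) = s≤s (size-∪ a b)
size-∪ (nothing ∷ a) (just _ ∷ b)  =
  subst (suc (size (Vec.zipWith _<∣>_ a b)) ≤_) (sym (ℕ.+-suc (size a) (size b))) (s≤s (size-∪ a b))
size-∪ (nothing ∷ a) (nothing ∷ b) = size-∪ a b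

Covers-∪⁻ : ∀ (θ : Thin k n) (q₁ q₂ : PCP n r) → Compatible q₁ q₂ → θ Covers (q₁ ∪ q₂) → θ Covers q₁ × θ Covers q₂
Covers-∪⁻ θ q₁ q₂ compatible cover =
  (λ s → cover (InSupp-∪⁺ q₁ q₂ compatible (inj₁ s))) , (λ s → cover (InSupp-∪⁺ q₁ q₂ compatible (inj₂ s)))

∣supp-∪∣≤ : ∀ (q₁ q₂ : PCP n r) → ∣ supp (q₁ ∪ q₂) ∣ ≤ ∣ supp q₁ ∣ + ∣ supp q₂ ∣
∣supp-∪∣≤ q₁ q₂ = ℕ.≤-trans (Subset.p⊆q⇒∣p∣≤∣q∣ supp-∪⊆) (∣p∪q∣≤∣p∣+∣q∣ (supp q₁) (supp q₂))
  where
  supp-∪⊆ : supp (q₁ ∪ q₂) ⊆ₛ supp q₁ ∪ₛ supp q₂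
  supp-∪⊆ m = Subset.x∈p∪q⁺ (Sum.map (∈-supp⁺ q₁) (∈-supp⁺ q₂) (InSupp-∪⁻ q₁ q₂ (∈-supp⁻ (q₁ ∪ q₂) m)))

-- Pair patterns

PCP-≟ : DecidableEquality (PCP k r)
PCP-≟ = Vec.≡-dec (Maybe.≡-dec (Prod.≡-dec Fin._≟_ Fin._≟_))

PairPattern : ℕ → Set
PairPattern r = Σ ℕ λ k → PCP k r × PCP k r

_≟ᵖ_ : DecidableEquality (PairPattern r)
_≟ᵖ_ = Prod.≡-dec ℕ._≟_ (Prod.≡-dec PCP-≟ PCP-≟)

allVecs : List A → (k : ℕ) → List (Vec A k)
allVecs xs zero    = [] ∷ []
allVecs xs (suc k) = cartesianProductWith _∷_ xs (allVecs xs k)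

∈-allVecs : ∀ {xs : List A} (v : Vec A k) → (∀ i → lookup v i ∈ xs) → v ∈ allVecs xs k
∈-allVecs []      _   = here refl
∈-allVecs (x ∷ v) mem = ∈-cartesianProductWith⁺ _∷_ (mem zero) (∈-allVecs v (mem ∘ suc))

allPCPs : (k r : ℕ) → List (PCP k r)
allPCPs k r = allVecs (nothing ∷ map just (cartesianProduct (allFin k) (allFin r))) k

∈-allPCPs : ∀ (p : PCP k r) → p ∈ allPCPs k r
∈-allPCPs p = ∈-allVecs p (entry ∘ lookup p)
  where
  entry : ∀ e → e ∈ nothing ∷ map just (cartesianProduct (allFin _) (allFin _))
  entry nothing        = here refl
  entry (just (j , c)) = there (∈-map⁺ just (∈-cartesianProduct⁺ (∈-allFin j) (∈-allFin c)))

pairPatternsOfSize : (k r : ℕ) → List (PairPattern r)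
pairPatternsOfSize k r = map (k ,_) (cartesianProduct (allPCPs k r) (allPCPs k r))

allPairPatterns : (N r : ℕ) → List (PairPattern r)
allPairPatterns N r = deduplicate _≟ᵖ_ (concatMap (λ k → pairPatternsOfSize k r) (upTo (suc N)))

∈-allPairPatterns : ∀ {N} (δ : PairPattern r) → proj₁ δ ≤ N → δ ∈ allPairPatterns N r
∈-allPairPatterns {r} (k , a , b) k≤N =
  ∈-deduplicate⁺ _≟ᵖ_ (∈-concatMap⁺ (λ k → pairPatternsOfSize k r) (Any.map mem (∈-upTo⁺ (s≤s k≤N))))
  where
  mem : ∀ {k′} → k ≡ k′ → (k , a , b) ∈ pairPatternsOfSize k′ r
  mem refl = ∈-map⁺ (k ,_) (∈-cartesianProduct⁺ (∈-allPCPs a) (∈-allPCPs b))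

Unique-allPairPatterns : ∀ N r → Unique (allPairPatterns N r)
Unique-allPairPatterns N r = Unique.deduplicate-! _≟ᵖ_ (concatMap (λ k → pairPatternsOfSize k r) (upTo (suc N)))

pairPatternOf : PCP n r × PCP n r → PairPattern r
pairPatternOf (q₁ , q₂) = ∣ supp (q₁ ∪ q₂) ∣ , pull θ q₁ , pull θ q₂
  where θ = suppᵗ (q₁ ∪ q₂)

pairPatternOf-push : ∀ (θ : Thin k n) (a b : PCP k r) → Full (a ∪ b) →
  pairPatternOf (push θ a , push θ b) ≡ (k , a , b)
pairPatternOf-push {k} θ a b full = begin
  pairPatternOf (push θ a , push θ b)
    ≡⟨ cong (λ { (k , θ′) → k , pull θ′ (push θ a) , pull θ′ (push θ b) }) (sym enumerated) ⟩
  (k , pull θ (push θ a) , pull θ (push θ b))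
    ≡⟨ cong₂ (λ a′ b′ → k , a′ , b′) (pull-push θ a) (pull-push θ b) ⟩
  (k , a , b) ∎
  where
  open ≡-Reasoning
  enumerated = enumerates-unique θ
    (subst (λ u → θ Enumerates supp u) (sym (push-∪ θ a b)) (push-enumerates-supp θ (a ∪ b) full))

pairPatternOf-injective : ∀ {q₁ q₂ q₁′ q₂′ : PCP n r} → Compatible q₁ q₂ → Compatible q₁′ q₂′ →
  q₁ ∪ q₂ ≡ q₁′ ∪ q₂′ → pairPatternOf (q₁ , q₂) ≡ pairPatternOf (q₁′ , q₂′) → (q₁ , q₂) ≡ (q₁′ , q₂′)
pairPatternOf-injective {q₁ = q₁} {q₂} {q₁′} {q₂′} compatible compatible′ ∪≡ pattern≡ =
  cong₂ _,_ (pull-injective θ cover₁ cover₁′ (Prod.,-injectiveˡ pulls≡))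
            (pull-injective θ cover₂ cover₂′ (Prod.,-injectiveʳ pulls≡))
  where
  u = q₁ ∪ q₂
  θ = suppᵗ u
  cover₁ = proj₁ (Covers-∪⁻ θ q₁ q₂ compatible (suppᵗ-covers u))
  cover₂ = proj₂ (Covers-∪⁻ θ q₁ q₂ compatible (suppᵗ-covers u))
  cover′ = Covers-∪⁻ θ q₁′ q₂′ compatible′ (subst (θ Covers_) ∪≡ (suppᵗ-covers u))
  cover₁′ = proj₁ cover′
  cover₂′ = proj₂ cover′
  pulls≡ : (pull θ q₁ , pull θ q₂) ≡ (pull θ q₁′ , pull θ q₂′)
  pulls≡ = Prod.,-injectiveʳ-UIP ℕ.≡-irrelevant
    (trans pattern≡ (cong (λ u → ∣ supp u ∣ , pull (suppᵗ u) q₁′ , pull (suppᵗ u) q₂′) (sym ∪≡)))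

-- Gluing two order-invariant sets along a pair pattern

module _ {n₀ n₁ r : ℕ} (C : PCP n₀ r → Set) (D : PCP n₁ r → Set) where

  Glued : PairPattern r → PCP (n₀ + n₁) r → Set
  Glued (k , a , b) p = Valid (a ∪ b) × Compatible a b × PatternOf C (patternOf a) × PatternOf D (patternOf b) ×
    patternOf p ≡ (k , a ∪ b)

  Glued-orderInvariant : ∀ δ → OrderInvariant (Glued δ)
  Glued-orderInvariant (k , a , b) = valid , (size (a ∪ b) , sized) , closed
    where
    valid : ∀ p → Glued (k , a , b) p → Valid p
    valid p (valid-a∪b , _ , _ , _ , eq) with θ , refl ← patternOf≡⇒push p eq = Valid-push⁺ θ (a ∪ b) valid-a∪b
    sized : ∀ p → Glued (k , a , b) p → size p ≡ size (a ∪ b)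
    sized p (_ , _ , _ , _ , eq) = trans (sym (size-patternOf p)) (cong (size ∘ proj₂) eq)
    closed : ∀ p → Glued (k , a , b) p → ∀ g → OrderPresOnSupp p g → ∀ q → IsImage g p q → Glued (k , a , b) q
    closed p (v , c , pa , pb , eq) g mono q im = v , c , pa , pb , trans (patternOf-IsImage p g mono q im) eq

  Glued-size : ∀ {m₁ m₂} → (∀ p → C p → size p ≤ m₁) → (∀ p → D p → size p ≤ m₂) →
    ∀ δ p → Glued δ p → size p ≤ m₁ + m₂
  Glued-size {m₁} {m₂} boundC boundD (k , a , b) p (_ , _ , pa , pb , eq) = begin
    size p              ≡⟨ size-patternOf p ⟨
    size (proj₂ (patternOf p)) ≡⟨ cong (size ∘ proj₂) eq ⟩
    size (a ∪ b)        ≤⟨ size-∪ a b ⟩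
    size a + size b     ≤⟨ ℕ.+-mono-≤ (PatternOf-size boundC a pa) (PatternOf-size boundD b pb) ⟩
    m₁ + m₂             ∎
    where open ℕ.≤-Reasoning

  ∣supp-∪∣≤n₀+n₁ : ∀ {n} {q₁ q₂ : PCP n r} → InCn C q₁ → InCn D q₂ → ∣ supp (q₁ ∪ q₂) ∣ ≤ n₀ + n₁
  ∣supp-∪∣≤n₀+n₁ {q₁ = q₁} {q₂} inC inD = ℕ.≤-trans (∣supp-∪∣≤ q₁ q₂)
    (ℕ.+-mono-≤ (PatternOf-bound q₁ (InCn⇒PatternOf q₁ inC)) (PatternOf-bound q₂ (InCn⇒PatternOf q₂ inD)))

  InCn-Glued⁺ : ∀ {n} (q₁ q₂ : PCP n r) → Compatible q₁ q₂ → Valid (q₁ ∪ q₂) → InCn C q₁ → InCn D q₂ →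
    InCn (Glued (pairPatternOf (q₁ , q₂))) (q₁ ∪ q₂)
  InCn-Glued⁺ q₁ q₂ compatible valid inC inD =
    PatternOf⇒InCn (Glued-orderInvariant (pairPatternOf (q₁ , q₂))) u
      (p , glued , trans (patternOf-push-Full ι (a ∪ b) full) (sym pattern-u))
    where
    u = q₁ ∪ q₂
    θ = suppᵗ u
    a = pull θ q₁
    b = pull θ q₂
    covers = Covers-∪⁻ θ q₁ q₂ compatible (suppᵗ-covers u)
    q₁≡ = push-pull θ q₁ (proj₁ covers)
    q₂≡ = push-pull θ q₂ (proj₂ covers)
    u≡ : u ≡ push θ (a ∪ b)
    u≡ = trans (cong₂ _∪_ q₁≡ q₂≡) (push-∪ θ a b)
    pattern-u : patternOf u ≡ (∣ supp u ∣ , a ∪ b)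
    pattern-u = cong (∣ supp u ∣ ,_) (trans (cong (pull θ) u≡) (pull-push θ (a ∪ b)))
    full = patternOf≡⇒Full u pattern-u
    ι = inclusion (∣supp-∪∣≤n₀+n₁ {q₁ = q₁} {q₂} inC inD)
    p = push ι (a ∪ b)
    glued : Glued (pairPatternOf (q₁ , q₂)) p
    glued = Valid-push⁻ θ (a ∪ b) (subst Valid u≡ valid) ,
            Compatible-push⁻ θ (subst₂ Compatible q₁≡ q₂≡ compatible) ,
            subst (PatternOf C) (trans (cong patternOf q₁≡) (patternOf-push θ a)) (InCn⇒PatternOf q₁ inC) ,
            subst (PatternOf D) (trans (cong patternOf q₂≡) (patternOf-push θ b)) (InCn⇒PatternOf q₂ inD) ,
            patternOf-push-Full ι (a ∪ b) full

  InCn-Glued⁻ : OrderInvariant C → OrderInvariant D → ∀ {n} {δ} (q : PCP n r) → InCn (Glued δ) q →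
    ∃₂ λ q₁ q₂ → q₁ ∪ q₂ ≡ q × pairPatternOf (q₁ , q₂) ≡ δ × Compatible q₁ q₂ × InCn C q₁ × InCn D q₂
  InCn-Glued⁻ oiC oiD {δ = k , a , b} q inGlued
    with p , (_ , compatible , pa , pb , pattern-p) , p≈q ← InCn⇒PatternOf q inGlued =
    push θ a , push θ b , trans (push-∪ θ a b) (sym q≡) , pairPatternOf-push θ a b (patternOf≡⇒Full q pattern-q) ,
    Compatible-push⁺ θ compatible ,
    PatternOf⇒InCn oiC (push θ a) (subst (PatternOf C) (sym (patternOf-push θ a)) pa) ,
    PatternOf⇒InCn oiD (push θ b) (subst (PatternOf D) (sym (patternOf-push θ b)) pb)
    where
    pattern-q = trans (sym p≈q) pattern-p
    θ = proj₁ (patternOf≡⇒push q pattern-q)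
    q≡ = proj₂ (patternOf≡⇒push q pattern-q)

-- Counting

module _ (_≟_ : DecidableEquality B) (f : A → B) where

  fibre : B → List A → List A
  fibre δ = filter (λ x → f x ≟ δ)

  private
    sum-map-+ : ∀ (g h : B → ℕ) Δ → sum (map (λ δ → g δ + h δ) Δ) ≡ sum (map g Δ) + sum (map h Δ)
    sum-map-+ g h []      = refl
    sum-map-+ g h (δ ∷ Δ) = trans (cong (g δ + h δ +_) (sum-map-+ g h Δ)) (+-interchange (g δ) (h δ) _ _)

    sum-fibres-[] : ∀ (Δ : List B) → sum (map (λ δ → length (fibre δ [])) Δ) ≡ 0
    sum-fibres-[] []      = refl
    sum-fibres-[] (_ ∷ Δ) = sum-fibres-[] Δ

    sum-fibres-singleton-∉ : ∀ x {Δ} → All (λ δ → ¬ f x ≡ δ) Δ → sum (map (λ δ → length (fibre δ (x ∷ []))) Δ) ≡ 0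
    sum-fibres-singleton-∉ x []                   = refl
    sum-fibres-singleton-∉ x {δ ∷ _} (f≢δ ∷ f≢Δ) with f x ≟ δ
    ... | yes f≡δ = contradiction f≡δ f≢δ
    ... | no _    = sum-fibres-singleton-∉ x f≢Δ

    sum-fibres-singleton : ∀ x {Δ} → Unique Δ → f x ∈ Δ → sum (map (λ δ → length (fibre δ (x ∷ []))) Δ) ≡ 1
    sum-fibres-singleton x {δ ∷ _} (f≢Δ ∷ _) (here refl) with f x ≟ δ
    ... | yes _   = cong suc (sum-fibres-singleton-∉ x f≢Δ)
    ... | no f≢δ  = contradiction refl f≢δ
    sum-fibres-singleton x {δ ∷ _} (δ∉Δ ∷ unique) (there mem) with f x ≟ δ
    ... | yes refl = contradiction refl (All.lookup δ∉Δ mem)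
    ... | no _     = sum-fibres-singleton x unique mem

    length-fibre-∷ : ∀ x xs δ → length (fibre δ (x ∷ xs)) ≡ length (fibre δ (x ∷ [])) + length (fibre δ xs)
    length-fibre-∷ x xs δ with f x ≟ δ
    ... | yes _ = refl
    ... | no _  = refl

  length≡sum-fibres : ∀ {Δ} → Unique Δ → ∀ xs → (∀ {x} → x ∈ xs → f x ∈ Δ) →
    length xs ≡ sum (map (λ δ → length (fibre δ xs)) Δ)
  length≡sum-fibres {Δ} _      []       _     = sym (sum-fibres-[] Δ)
  length≡sum-fibres {Δ} unique (x ∷ xs) cover = begin
    suc (length xs)
      ≡⟨ cong₂ _+_ (sym (sum-fibres-singleton x unique (cover (here refl))))
                   (length≡sum-fibres unique xs (cover ∘ there)) ⟩
    sum (map (λ δ → length (fibre δ (x ∷ []))) Δ) + sum (map (λ δ → length (fibre δ xs)) Δ)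
      ≡⟨ sum-map-+ (λ δ → length (fibre δ (x ∷ []))) (λ δ → length (fibre δ xs)) Δ ⟨
    sum (map (λ δ → length (fibre δ (x ∷ [])) + length (fibre δ xs)) Δ)
      ≡⟨ cong sum (List.map-cong (λ δ → sym (length-fibre-∷ x xs δ)) Δ) ⟩
    sum (map (λ δ → length (fibre δ (x ∷ xs))) Δ) ∎
    where open ≡-Reasoning

length-cartesianProduct : ∀ (xs : List A) (ys : List B) → length (cartesianProduct xs ys) ≡ length xs ℕ.* length ys
length-cartesianProduct []       ys = refl
length-cartesianProduct (x ∷ xs) ys =
  trans (List.length-++ (map (x ,_) ys)) (cong₂ _+_ (List.length-map (x ,_) ys) (length-cartesianProduct xs ys))

Unique-map⁺ : ∀ {P : A → Set} (f : A → B) → (∀ {x y} → P x → P y → f x ≡ f y → x ≡ y) →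
  ∀ {xs} → All P xs → Unique xs → Unique (map f xs)
Unique-map⁺ f injective []         []            = []
Unique-map⁺ f injective (px ∷ pxs) (x∉xs ∷ unique) =
  All.map⁺ (All.zipWith (λ (py , x≢y) fx≡fy → x≢y (injective px py fx≡fy)) (pxs , x∉xs)) ∷
  Unique-map⁺ f injective pxs unique

toℚ : ℕ → ℚ
toℚ n = ℤ.+ n / 1

toℚ-mkℚ : ∀ n → toℚ n ≡ mkℚ (ℤ.+ n) 0 (Coprime.sym (Coprime.1-coprimeTo n))
toℚ-mkℚ n = ℚ.normalize-coprime (Coprime.sym (Coprime.1-coprimeTo n))

toℚ-* : ∀ m n → toℚ m * toℚ n ≡ toℚ (m ℕ.* n)
toℚ-* m n rewrite toℚ-mkℚ m | toℚ-mkℚ n = ℚ./-cong (sym (ℤ.pos-* m n)) refl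

toℚ-+ : ∀ m n → toℚ m +ℚ toℚ n ≡ toℚ (m + n)
toℚ-+ m n rewrite toℚ-mkℚ m | toℚ-mkℚ n =
  ℚ./-cong (trans (cong₂ ℤ._+_ (ℤ.*-identityʳ (ℤ.+ m)) (ℤ.*-identityʳ (ℤ.+ n))) (sym (ℤ.pos-+ m n))) refl

ListsMatching : ∀ {n₀ n r} → (PCP n₀ r → Set) → Permutation′ n → (Fin n → Fin r) → List (PCP n r) → Set
ListsMatching C ω τ L = ∀ q → (q ∈ L → InCn C q × Matches q ω τ) × (InCn C q × Matches q ω τ → q ∈ L)

Counting : ∀ {n₀ r} → (PCP n₀ r → Set) → Stat r → (n : ℕ) → Permutation′ n → (Fin n → Fin r) → Set
Counting C X n ω τ = ∃ λ L → Unique L × ListsMatching C ω τ L × X n ω τ ≡ toℚ (length L)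

module GluedLists {n₀ n₁ r n} {C : PCP n₀ r → Set} {D : PCP n₁ r → Set} {X Y : Stat r}
  {ω : Permutation′ n} {τ : Fin n → Fin r} (oiC : OrderInvariant C) (oiD : OrderInvariant D)
  (countX : Counting C X n ω τ) (countY : Counting D Y n ω τ) where

  private
    LX = proj₁ countX
    LY = proj₁ countY
    listsX = proj₁ (proj₂ (proj₂ countX))
    listsY = proj₁ (proj₂ (proj₂ countY))

  pairs : List (PCP n r × PCP n r)
  pairs = cartesianProduct LX LY

  glued : PairPattern r → List (PCP n r)
  glued δ = map (uncurry _∪_) (fibre _≟ᵖ_ pairPatternOf δ pairs)

  matching-pair : ∀ {q₁ q₂} → (q₁ , q₂) ∈ pairs → (InCn C q₁ × Matches q₁ ω τ) × (InCn D q₂ × Matches q₂ ω τ)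
  matching-pair mem = Prod.map (proj₁ (listsX _)) (proj₁ (listsY _)) (∈-cartesianProduct⁻ LX LY mem)

  glued-pair : ∀ {q₁ q₂} → (q₁ , q₂) ∈ pairs →
    InCn (Glued C D (pairPatternOf (q₁ , q₂))) (q₁ ∪ q₂) × Matches (q₁ ∪ q₂) ω τ
  glued-pair {q₁} {q₂} mem =
    InCn-Glued⁺ C D q₁ q₂ (Matches⇒Compatible ω τ q₁ q₂ match₁ match₂) (Matches⇒Valid ω τ (q₁ ∪ q₂) match)
      (proj₁ (proj₁ matching)) (proj₁ (proj₂ matching)) ,
    match
    where
    matching = matching-pair mem
    match₁ : Matches q₁ ω τ
    match₁ = proj₂ (proj₁ matching)
    match₂ : Matches q₂ ω τ
    match₂ = proj₂ (proj₂ matching)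
    match : Matches (q₁ ∪ q₂) ω τ
    match = Matches-∪ ω τ q₁ q₂ match₁ match₂

  glued-sound : ∀ δ q → q ∈ glued δ → InCn (Glued C D δ) q × Matches q ω τ
  glued-sound δ q q∈ with ((q₁ , q₂) , ∈fibre , q≡) ← ∈-map⁻ (uncurry _∪_) q∈
    with mem , pattern≡ ← ∈-filter⁻ (λ pr → pairPatternOf pr ≟ᵖ δ) ∈fibre =
    subst₂ (λ δ q → InCn (Glued C D δ) q × Matches q ω τ) {pairPatternOf (q₁ , q₂)} {δ} {q₁ ∪ q₂} {q}
      pattern≡ (sym q≡) (glued-pair {q₁} {q₂} mem)

  ∈-glued : ∀ {δ q₁ q₂} → (q₁ , q₂) ∈ pairs → pairPatternOf (q₁ , q₂) ≡ δ → q₁ ∪ q₂ ∈ glued δ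
  ∈-glued {δ} mem pattern≡ = ∈-map⁺ (uncurry _∪_) (∈-filter⁺ (λ pr → pairPatternOf pr ≟ᵖ δ) mem pattern≡)

  glued-complete : ∀ δ q → InCn (Glued C D δ) q × Matches q ω τ → q ∈ glued δ
  glued-complete δ q (inGlued , match) = from-decomposition (InCn-Glued⁻ C D oiC oiD q inGlued)
    where
    from-decomposition : (∃₂ λ q₁ q₂ → q₁ ∪ q₂ ≡ q × pairPatternOf (q₁ , q₂) ≡ δ × Compatible q₁ q₂ ×
      InCn C q₁ × InCn D q₂) → q ∈ glued δ
    from-decomposition (q₁ , q₂ , ∪≡ , pattern≡ , compatible , inC , inD) =
      subst (_∈ glued δ) ∪≡ (∈-glued {δ} {q₁} {q₂} mem pattern≡)
      where
      match′ : Matches (q₁ ∪ q₂) ω τ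
      match′ = subst (λ q → Matches q ω τ) (sym ∪≡) match
      mem : (q₁ , q₂) ∈ pairs
      mem = ∈-cartesianProduct⁺ (proj₂ (listsX q₁) (inC , Matches-∪⁻ˡ ω τ q₁ q₂ match′))
                                (proj₂ (listsY q₂) (inD , Matches-∪⁻ʳ ω τ q₁ q₂ compatible match′))

  glued-unique : ∀ δ → Unique (glued δ)
  glued-unique δ = Unique-map⁺ (uncurry _∪_) injective
    (All.tabulate (∈-filter⁻ (λ pr → pairPatternOf pr ≟ᵖ δ)))
    (Unique.filter⁺ _ (Unique.cartesianProduct⁺ (proj₁ (proj₂ countX)) (proj₁ (proj₂ countY))))
    where
    compatible : ∀ {q₁ q₂} → (q₁ , q₂) ∈ pairs → Compatible q₁ q₂
    compatible {q₁} {q₂} mem =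
      Matches⇒Compatible ω τ q₁ q₂ (proj₂ (proj₁ (matching-pair mem))) (proj₂ (proj₂ (matching-pair mem)))
    injective : ∀ {pr pr′} → pr ∈ pairs × pairPatternOf pr ≡ δ → pr′ ∈ pairs × pairPatternOf pr′ ≡ δ →
      uncurry _∪_ pr ≡ uncurry _∪_ pr′ → pr ≡ pr′
    injective {q₁ , q₂} {q₁′ , q₂′} (mem , pattern≡δ) (mem′ , pattern′≡δ) ∪≡ =
      pairPatternOf-injective {q₁ = q₁} {q₂} {q₁′} {q₂′} (compatible mem) (compatible mem′) ∪≡
        (trans pattern≡δ (sym pattern′≡δ))

  pairPattern-bound : ∀ {pr} → pr ∈ pairs → proj₁ (pairPatternOf pr) ≤ n₀ + n₁
  pairPattern-bound {q₁ , q₂} mem =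
    ∣supp-∪∣≤n₀+n₁ C D {q₁ = q₁} {q₂} (proj₁ (proj₁ (matching-pair mem))) (proj₁ (proj₂ (matching-pair mem)))

  length-pairs : length LX ℕ.* length LY ≡ sum (map (length ∘ glued) (allPairPatterns (n₀ + n₁) r))
  length-pairs = begin
    length LX ℕ.* length LY
      ≡⟨ length-cartesianProduct LX LY ⟨
    length pairs
      ≡⟨ length≡sum-fibres _≟ᵖ_ pairPatternOf (Unique-allPairPatterns (n₀ + n₁) r) pairs
           (λ {pr} mem → ∈-allPairPatterns (pairPatternOf pr) (pairPattern-bound mem)) ⟩
    sum (map (λ δ → length (fibre _≟ᵖ_ pairPatternOf δ pairs)) Δ)
      ≡⟨ cong sum (List.map-cong (λ δ → sym (List.length-map (uncurry _∪_) (fibre _≟ᵖ_ pairPatternOf δ pairs))) Δ) ⟩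
    sum (map (length ∘ glued) Δ) ∎
    where
    open ≡-Reasoning
    Δ = allPairPatterns (n₀ + n₁) r

  ⊙≡sum-glued : (X ⊙ Y) n ω τ ≡ toℚ (sum (map (length ∘ glued) (allPairPatterns (n₀ + n₁) r)))
  ⊙≡sum-glued = begin
    X n ω τ * Y n ω τ                  ≡⟨ cong₂ _*_ (proj₂ (proj₂ (proj₂ countX))) (proj₂ (proj₂ (proj₂ countY))) ⟩
    toℚ (length LX) * toℚ (length LY)  ≡⟨ toℚ-* (length LX) (length LY) ⟩
    toℚ (length LX ℕ.* length LY)      ≡⟨ cong toℚ length-pairs ⟩
    toℚ (sum (map (length ∘ glued) (allPairPatterns (n₀ + n₁) r))) ∎
    where open ≡-Reasoning

-- Linear spans

module _ {r : ℕ} where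

  Generators : (Stat r → Set₁) → Set₁
  Generators P = List (ℚ × Σ (Stat r) P)

  weighted : ∀ {P : Stat r → Set₁} → ℚ × Σ (Stat r) P → Stat r
  weighted t n ω τ = proj₁ t * proj₁ (proj₂ t) n ω τ

  combination : ∀ {P : Stat r → Set₁} → Generators P → Stat r
  combination L n ω τ = foldr (λ t acc → weighted t n ω τ +ℚ acc) 0ℚ L

  scale : ∀ {P : Stat r → Set₁} → ℚ → Generators P → Generators P
  scale s = map (λ t → s * proj₁ t , proj₂ t)

  module _ {P : Stat r → Set₁} {n : ℕ} {ω : Permutation′ n} {τ : Fin n → Fin r} where

    combination-++ : ∀ (L L′ : Generators P) →
      combination (L ++ L′) n ω τ ≡ combination L n ω τ +ℚ combination L′ n ω τ
    combination-++ []      L′ = sym (ℚ.+-identityˡ (combination L′ n ω τ))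
    combination-++ (t ∷ L) L′ = trans (cong (weighted t n ω τ +ℚ_) (combination-++ L L′))
      (sym (ℚ.+-assoc (weighted t n ω τ) (combination L n ω τ) (combination L′ n ω τ)))

    combination-scale : ∀ s (L : Generators P) → combination (scale s L) n ω τ ≡ s * combination L n ω τ
    combination-scale s []      = sym (ℚ.*-zeroʳ s)
    combination-scale s (t ∷ L) =
      trans (cong₂ _+ℚ_ (ℚ.*-assoc s (proj₁ t) _) (combination-scale s L)) (sym (ℚ.*-distribˡ-+ s _ _))

  InSpan-mono : ∀ {P Q : Stat r → Set₁} → (∀ S → P S → Q S) → ∀ {S} → InSpan P S → InSpan Q S
  InSpan-mono {P} {Q} P⇒Q (L , S≈L) = map relabel L , λ n n≥1 ω τ →
    trans (S≈L n n≥1 ω τ) (sym (List.foldr-map _ relabel 0ℚ L))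
    where
    relabel : ℚ × Σ (Stat r) P → ℚ × Σ (Stat r) Q
    relabel t = proj₁ t , proj₁ (proj₂ t) , P⇒Q _ (proj₂ (proj₂ t))

  InSpan-⊙ : ∀ {P P′ Q : Stat r → Set₁} → (∀ X Y → P X → P′ Y → InSpan Q (X ⊙ Y)) →
    ∀ {X Y} → InSpan P X → InSpan P′ Y → InSpan Q (X ⊙ Y)
  InSpan-⊙ {P} {P′} {Q} span⊙ {X} {Y} (LX , X≈) (LY , Y≈) = products LX , λ n n≥1 ω τ →
    trans (cong₂ _*_ (X≈ n n≥1 ω τ) (Y≈ n n≥1 ω τ)) (sym (combination-products n≥1 LX))
    where
    product : ℚ × Σ (Stat r) P → ℚ × Σ (Stat r) P′ → Generators Q
    product (a , X′ , pX) (b , Y′ , pY) = scale (a * b) (proj₁ (span⊙ X′ Y′ pX pY))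
    products : Generators P → Generators Q
    products = concatMap (λ tx → concatMap (product tx) LY)
    module _ {n} (n≥1 : 1 ≤ n) {ω : Permutation′ n} {τ : Fin n → Fin r} where
      combination-product : ∀ tx ty → combination (product tx ty) n ω τ ≡ weighted tx n ω τ * weighted ty n ω τ
      combination-product (a , X′ , pX) (b , Y′ , pY) = begin
        combination (scale (a * b) L) n ω τ  ≡⟨ combination-scale {n = n} {ω} {τ} (a * b) L ⟩
        (a * b) * combination L n ω τ        ≡⟨ cong ((a * b) *_) (proj₂ (span⊙ X′ Y′ pX pY) n n≥1 ω τ) ⟨
        (a * b) * (X′ n ω τ * Y′ n ω τ)      ≡⟨ *-interchange a b (X′ n ω τ) (Y′ n ω τ) ⟩
        (a * X′ n ω τ) * (b * Y′ n ω τ)      ∎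
        where
        open ≡-Reasoning
        L = proj₁ (span⊙ X′ Y′ pX pY)
      combination-row : ∀ tx L → combination (concatMap (product tx) L) n ω τ ≡ weighted tx n ω τ * combination L n ω τ
      combination-row tx []       = sym (ℚ.*-zeroʳ (weighted tx n ω τ))
      combination-row tx (ty ∷ L) = begin
        combination (product tx ty ++ concatMap (product tx) L) n ω τ
          ≡⟨ combination-++ {n = n} {ω} {τ} (product tx ty) (concatMap (product tx) L) ⟩
        combination (product tx ty) n ω τ +ℚ combination (concatMap (product tx) L) n ω τ
          ≡⟨ cong₂ _+ℚ_ (combination-product tx ty) (combination-row tx L) ⟩
        weighted tx n ω τ * weighted ty n ω τ +ℚ weighted tx n ω τ * combination L n ω τ
          ≡⟨ ℚ.*-distribˡ-+ (weighted tx n ω τ) (weighted ty n ω τ) (combination L n ω τ) ⟨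
        weighted tx n ω τ * combination (ty ∷ L) n ω τ ∎
        where open ≡-Reasoning
      combination-products : ∀ L → combination (products L) n ω τ ≡ combination L n ω τ * combination LY n ω τ
      combination-products []       = sym (ℚ.*-zeroˡ (combination LY n ω τ))
      combination-products (tx ∷ L) = begin
        combination (concatMap (product tx) LY ++ products L) n ω τ
          ≡⟨ combination-++ {n = n} {ω} {τ} (concatMap (product tx) LY) (products L) ⟩
        combination (concatMap (product tx) LY) n ω τ +ℚ combination (products L) n ω τ
          ≡⟨ cong₂ _+ℚ_ (combination-row tx LY) (combination-products L) ⟩
        weighted tx n ω τ * combination LY n ω τ +ℚ combination L n ω τ * combination LY n ω τ
          ≡⟨ ℚ.*-distribʳ-+ (combination LY n ω τ) (weighted tx n ω τ) (combination L n ω τ) ⟨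
        combination (tx ∷ L) n ω τ * combination LY n ω τ ∎
        where open ≡-Reasoning

-- The product of two extensions

IsOIExt⇒IsOIExtSz : ∀ {r} {X : Stat r} → IsOIExt r X → ∃ λ m → IsOIExtSz r m X
IsOIExt⇒IsOIExtSz (n₀ , 2≤n₀ , C , oi@(_ , (m , sized) , _) , ext) =
  m , n₀ , 2≤n₀ , C , oi , (λ p Cp → ℕ.≤-reflexive (sized p Cp)) , ext

IsOIExtSz⇒IsOIExt : ∀ {r m} (X : Stat r) → IsOIExtSz r m X → IsOIExt r X
IsOIExtSz⇒IsOIExt X (n₀ , 2≤n₀ , C , oi , _ , ext) = n₀ , 2≤n₀ , C , oi , ext

⊙-IsOIExtSz : ∀ {r m₁ m₂} (X Y : Stat r) → IsOIExtSz r m₁ X → IsOIExtSz r m₂ Y → 𝓘≤ r (m₁ + m₂) (X ⊙ Y)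
⊙-IsOIExtSz {r} {m₁} {m₂} X Y (n₀ , 2≤n₀ , C , oiC , boundC , extX) (n₁ , _ , D , oiD , boundD , extY) =
  map generator Δ , λ { (suc n) _ ω τ → trans (G.⊙≡sum-glued n ω τ) (sum≡combination n ω τ Δ) }
  where
  Δ = allPairPatterns (n₀ + n₁) r
  module G (n : ℕ) (ω : Permutation′ (suc n)) (τ : Fin (suc n) → Fin r) =
    GluedLists {X = X} {Y = Y} oiC oiD (extX (suc n) (s≤s z≤n) ω τ) (extY (suc n) (s≤s z≤n) ω τ)
  Z : PairPattern r → Stat r
  Z δ zero    _ _ = 0ℚ  -- irrelevant: extensions and spans only constrain n ≥ 1
  Z δ (suc n) ω τ = toℚ (length (G.glued n ω τ δ))
  Z-extension : ∀ δ → IsExtensionOf (Glued C D δ) (Z δ)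
  Z-extension δ (suc n) _ ω τ =
    G.glued n ω τ δ , G.glued-unique n ω τ δ , (λ q → G.glued-sound n ω τ δ q , G.glued-complete n ω τ δ q) , refl
  generator : PairPattern r → ℚ × Σ (Stat r) (IsOIExtSz r (m₁ + m₂))
  generator δ = 1ℚ , Z δ , n₀ + n₁ , ℕ.≤-trans 2≤n₀ (ℕ.m≤m+n n₀ n₁) , Glued C D δ ,
    Glued-orderInvariant C D δ , Glued-size C D boundC boundD δ , Z-extension δ
  sum≡combination : ∀ n ω τ Δ′ →
    toℚ (sum (map (length ∘ G.glued n ω τ) Δ′)) ≡ combination (map generator Δ′) (suc n) ω τ
  sum≡combination n ω τ []       = refl
  sum≡combination n ω τ (δ ∷ Δ′) = trans (sym (toℚ-+ (length (G.glued n ω τ δ)) _))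
    (cong₂ _+ℚ_ (sym (ℚ.*-identityˡ (toℚ (length (G.glued n ω τ δ))))) (sum≡combination n ω τ Δ′))

lemma3p30 : ∀ (r : ℕ) → 1 ≤ r →
    (∀ (X Y : Stat r) → IsOIExt r X → IsOIExt r Y → 𝓘 r (X ⊙ Y)) ×
    (∀ (m₁ m₂ : ℕ) (X Y : Stat r) → 𝓘≤ r m₁ X → 𝓘≤ r m₂ Y → 𝓘≤ r (m₁ + m₂) (X ⊙ Y))
lemma3p30 r _ =  -- the argument works for every r, including r = 0
  (λ X Y x y → InSpan-mono IsOIExtSz⇒IsOIExt
     (⊙-IsOIExtSz X Y (proj₂ (IsOIExt⇒IsOIExtSz x)) (proj₂ (IsOIExt⇒IsOIExtSz y)))) ,
  (λ _ _ _ _ → InSpan-⊙ ⊙-IsOIExtSz)
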